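{- Let $\mathbb D=\langle D,\leq_{\mathbb D}\rangle$ be a directed set, $\mathbb I=\langle\langle G_q: q\in D\rangle,\langle h_{q,r}: q\leq_{\mathbb D} r\rangle\rangle$ an inverse system of groups over $\mathbb D$, and $\mathcal M_{\mathbb I}$ the structure described below. If $\sigma$ is an automorphism of $\mathcal M_{\mathbb I}$ and $q\in D$, then there is a unique $c_{\sigma,q}\in G_q$ such that $\sigma(\langle g,q,0\rangle)=\langle c_{\sigma,q}\cdot g,q,0\rangle$ for all $g\in G_q$.
   Context: A directed set is a set with a reflexive transitive relation in which any two elements have a common upper bound. An inverse system of groups over it consists of groups $G_q$ and homomorphisms $h_{q,r}:G_r\to G_q$ ($q\leq_{\mathbb D} r$) with $h_{q,q}=\mathrm{id}$ and $h_{q,r}\circ h_{r,s}=h_{q,s}$. The first-order language $\mathcal L_{\mathbb I}$ has constant symbols $\dot c_{g,q}$ ($q\in D$, $g\in G_q$), unary relation symbols $\dot P_q$ ($q\in D$), binary relation symbols $\dot H_{q,r}$ ($q\leq_{\mathbb D} r$) and ternary relation symbols $\dot F_q$ ($q\in D$). The $\mathcal L_{\mathbb I}$-structure $\mathcal M_{\mathbb I}$ has domain $\{\langle g,q,i\rangle: q\in D, g\in G_q, i<2\}$, interprets $\dot c_{g,q}$ as $\langle g,q,1\rangle$, $\dot P_q$ as $\{\langle g,q,0\rangle: g\in G_q\}$, $\dot H_{q,r}$ as $\{(\langle g,r,0\rangle,\langle h_{q,r}(g),q,0\rangle): g\in G_r\}$, and $\dot F_q$ as $\{(\langle g,q,0\rangle,\langle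 h,q,1\rangle,\langle g\cdot h,q,0\rangle): g,h\in G_q\}$. -}

module Defs where

open import Level using (Level; _⊔_)
open import Data.Product using (Σ; ∃; ∃-syntax; _×_; _,_)
open import Data.Fin using (Fin; zero; suc)
open import Relation.Binary.PropositionalEquality using (_≡_)
open import Algebra.Structures using (IsGroup)
open import Function.Definitions using (Bijective)
open import Function.Bundles using (_⇔_)

record DirectedSet (d ℓ : Level) : Set (Level.suc (d ⊔ ℓ)) where
  field
    Carrier  : Set d
    _≤_      : Carrier → Carrier → Set ℓ
    ≤-refl   : ∀ x → x ≤ x
    ≤-trans  : ∀ {x y z} → x ≤ y → y ≤ z → x ≤ z
    directed : ∀ x y → ∃[ z ] (x ≤ z × y ≤ z)

record PGroup (g : Level) : Set (Level.suc g) where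
  field
    Carrier : Set g
    _∙_     : Carrier → Carrier → Carrier
    ε       : Carrier
    _⁻¹     : Carrier → Carrier
    isGroup : IsGroup _≡_ _∙_ ε _⁻¹

open PGroup using (Carrier; _∙_) public

-- An inverse system of groups over a directed set.
-- h_{q,r} is indexed by a proof of q ≤ r; the coherence laws are required for
-- all proofs, which in particular makes h independent of the chosen proof.
record InverseSystem {d ℓ : Level} (𝔻 : DirectedSet d ℓ) (g : Level)
       : Set (d ⊔ ℓ ⊔ Level.suc g) where
  open DirectedSet 𝔻 renaming (Carrier to D)
  field
    G     : D → PGroup g
    h     : ∀ {q r} → q ≤ r → PGroup.Carrier (G r) → PGroup.Carrier (G q)
    h-hom : ∀ {q r} (p : q ≤ r) (x y : PGroup.Carrier (G r)) →
            h p (PGroup._∙_ (G r) x y) ≡ PGroup._∙_ (G q) (h p x) (h p y)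
    h-id  : ∀ {q} (p : q ≤ q) (x : PGroup.Carrier (G q)) → h p x ≡ x
    h-comp : ∀ {q r s} (p : q ≤ r) (p' : r ≤ s) (p'' : q ≤ s)
             (x : PGroup.Carrier (G s)) → h p (h p' x) ≡ h p'' x

module _ {d ℓ g : Level} {𝔻 : DirectedSet d ℓ} (𝕀 : InverseSystem 𝔻 g) where
  open DirectedSet 𝔻 renaming (Carrier to D)
  open InverseSystem 𝕀

  record LStructure (u v : Level) : Set (d ⊔ ℓ ⊔ g ⊔ Level.suc (u ⊔ v)) where
    field
      U : Set u
      c : (q : D) → PGroup.Carrier (G q) → U
      P : D → U → Set v
      H : (q r : D) → q ≤ r → U → U → Set v
      F : D → U → U → U → Set v

  record Automorphism {u v : Level} (M : LStructure u v) : Set (d ⊔ ℓ ⊔ g ⊔ u ⊔ v) where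
    open LStructure M
    field
      σ       : U → U
      σ-bij   : Bijective _≡_ _≡_ σ
      σ-c     : ∀ q (x : PGroup.Carrier (G q)) → σ (c q x) ≡ c q x
      σ-P     : ∀ q x → P q x ⇔ P q (σ x)
      σ-H     : ∀ q r (p : q ≤ r) x y → H q r p x y ⇔ H q r p (σ x) (σ y)
      σ-F     : ∀ q x y z → F q x y z ⇔ F q (σ x) (σ y) (σ z)

  Dom : Set (d ⊔ g)
  Dom = Σ D (λ q → PGroup.Carrier (G q) × Fin 2)

  -- elt q x i  represents the paper's triple ⟨x , q , i⟩.
  elt : (q : D) → PGroup.Carrier (G q) → Fin 2 → Dom
  elt q x i = q , x , i

  M𝕀 : LStructure (d ⊔ g) (d ⊔ g)
  M𝕀 = record
    { U = Dom
    ; c = λ q x → elt q (x) (suc zero)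
    ; P = λ q a → ∃[ x ] (a ≡ elt q (x) (zero))
    ; H = λ q r p a b → ∃[ x ] (a ≡ elt r (x) (zero) × b ≡ elt q (h p x) (zero))
    ; F = λ q a b e → ∃[ x ] ∃[ y ]
            (a ≡ elt q (x) (zero) × b ≡ elt q (y) (suc zero)
              × e ≡ elt q (PGroup._∙_ (G q) x y) (zero))
    }

module Submission where

-- An automorphism σ of M_𝕀 preserves P_q, so
-- it maps the sort-0 element ⟨ε,q,0⟩ to some ⟨c,q,0⟩; this c is c_{σ,q}.
-- Since σ fixes every constant ⟨y,q,1⟩ and preserves F_q, the F_q-fact
-- (⟨x,q,0⟩, ⟨y,q,1⟩, ⟨x·y,q,0⟩) is carried to a fact saying that σ
-- commutes with right multiplication by y on sort 0:
--     σ⟨x,q,0⟩ = ⟨x',q,0⟩   implies   σ⟨x·y,q,0⟩ = ⟨x'·y,q,0⟩.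
-- Taking x = ε gives σ⟨y,q,0⟩ = ⟨c·y,q,0⟩ for every y.  Uniqueness follows
-- by evaluating at y = ε, since c·ε = c.

open import Defs
open import Level using (Level)
open import Data.Product using (∃; ∃!; _,_; proj₁; proj₂; Σ; _×_)
open import Data.Fin using (Fin; zero; suc)
open import Relation.Binary.PropositionalEquality
  using (_≡_; refl; sym; trans; cong₂; subst; module ≡-Reasoning)
open import Function.Bundles using (Equivalence)
open import Algebra.Structures using (IsGroup)

triple-injective : ∀ {a b} {A : Set a} {B : A → Set b} {q : A} {x y : B q}
  {i j : Fin 2} →
  _≡_ {A = Σ A (λ q → B q × Fin 2)} (q , x , i) (q , y , j) → x ≡ y
triple-injective refl = refl

module _ {d ℓ g : Level} {𝔻 : DirectedSet d ℓ} (𝕀 : InverseSystem 𝔻 g)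
         (A : Automorphism 𝕀 (M𝕀 𝕀)) where
  open InverseSystem 𝕀
  open Automorphism A

  σ-sort₀ : ∀ q (x : Carrier (G q)) →
            ∃ λ x' → σ (elt 𝕀 q x zero) ≡ elt 𝕀 q x' zero
  σ-sort₀ q x = Equivalence.to (σ-P q (elt 𝕀 q x zero)) (x , refl)

  -- σ commutes with right translation by y on sort 0: this is the image under
  -- σ of the fact F_q(⟨x,q,0⟩, ⟨y,q,1⟩, ⟨x·y,q,0⟩), using σ⟨y,q,1⟩ = ⟨y,q,1⟩.
  σ-right-translation : ∀ q (x x' y : Carrier (G q)) →
    σ (elt 𝕀 q x zero) ≡ elt 𝕀 q x' zero →
    σ (elt 𝕀 q (_∙_ (G q) x y) zero) ≡ elt 𝕀 q (_∙_ (G q) x' y) zero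
  σ-right-translation q x x' y σx≡x'
    with Equivalence.to
           (σ-F q (elt 𝕀 q x zero) (elt 𝕀 q y (suc zero))
                  (elt 𝕀 q (_∙_ (G q) x y) zero))
           (x , y , refl , refl , refl)
  ... | a , b , σx≡a , σy≡b , σxy≡ab =
    subst (λ z → σ (elt 𝕀 q (_∙_ (G q) x y) zero) ≡ elt 𝕀 q z zero)
          (cong₂ (_∙_ (G q)) a≡x' b≡y) σxy≡ab
    where
    a≡x' : a ≡ x'
    a≡x' = triple-injective (trans (sym σx≡a) σx≡x')
    b≡y : b ≡ y
    b≡y = triple-injective (trans (sym σy≡b) (σ-c q y))

proposition2p9 : {d ℓ g : Level} {𝔻 : DirectedSet d ℓ} (𝕀 : InverseSystem 𝔻 g)
    (A : Automorphism 𝕀 (M𝕀 𝕀)) (q : DirectedSet.Carrier 𝔻) →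
    ∃! _≡_ (λ (c : Carrier (InverseSystem.G 𝕀 q)) →
      ∀ (x : Carrier (InverseSystem.G 𝕀 q)) →
        Automorphism.σ A (elt 𝕀 q x zero)
          ≡ elt 𝕀 q (_∙_ (InverseSystem.G 𝕀 q) c x) zero)
proposition2p9 𝕀 A q = c , σ-is-translation , uniqueness
  where
  open InverseSystem 𝕀 using (G)
  open Automorphism A using (σ)
  open PGroup (G q) using (ε; isGroup) renaming (_∙_ to _·_)
  open IsGroup isGroup using (identityˡ; identityʳ)

  c : Carrier (G q)
  c = proj₁ (σ-sort₀ 𝕀 A q ε)

  σ-is-translation : ∀ x → σ (elt 𝕀 q x zero) ≡ elt 𝕀 q (c · x) zero
  σ-is-translation x =
    subst (λ z → σ (elt 𝕀 q z zero) ≡ elt 𝕀 q (c · x) zero) (identityˡ x)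
          (σ-right-translation 𝕀 A q ε c x (proj₂ (σ-sort₀ 𝕀 A q ε)))

  uniqueness : ∀ {c'} → (∀ x → σ (elt 𝕀 q x zero) ≡ elt 𝕀 q (c' · x) zero) →
               c ≡ c'
  uniqueness {c'} σ≡c'· = begin
    c       ≡⟨ sym (identityʳ c) ⟩
    c · ε   ≡⟨ triple-injective (trans (sym (σ-is-translation ε)) (σ≡c'· ε)) ⟩
    c' · ε  ≡⟨ identityʳ c' ⟩
    c'      ∎
    where open ≡-Reasoning
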